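{- For every multigraph $G$ and every family $\mathcal{F}$ of multigraphs, $\mathrm{wsat}(G,\mathcal{F})\geq\mathrm{rk}\text{ - }\mathrm{sat}(G,\mathcal{F})$.
   Context: A multigraph on vertex set $V$ has as edge set a multiset of pairs from $\binom{V}{2}$; different instances of the same pair are regarded as distinct edges. A copy of a multigraph $F$ in $G$ is a submultigraph of $G$ isomorphic to $F$. A submultigraph $H$ of $G$ (on the same vertex set) is weakly $\mathcal{F}$-saturated in $G$ if $G$ can be obtained from $H$ by adding the missing edge instances one at a time so that each added edge lies in a copy of some $F\in\mathcal{F}$ in the current multigraph; $\mathrm{wsat}(G,\mathcal{F})$ is the minimum number of edges of such an $H$. A matroid $M$ on ground set $E(G)$ (instances of the same pair being distinct elements) is weakly $\mathcal{F}$-saturated if for every $F\in\mathcal{F}$ every copy $\tilde F$ of $F$ in $G$ is a cycle of $M$, i.e. $\mathrm{rk}_M(E(\tilde F)\setminus\{e\})=\mathrm{rk}_M(E(\tilde F))$ for all $e\in E(\tilde F)$. $\mathrm{rk}\text{ - }\mathrm{sat}(G,\mathcal{F})$ is the maximum rank of a weakly $\mathcal{F}$-saturated matroid on $E(G)$. -}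

module Defs where

open import Data.Nat using (ℕ; _≤_; _+_)
open import Data.Fin using (Fin)
open import Data.Fin.Subset using (Subset; _∈_; _∉_; _⊆_; _∪_; _∩_; _-_; ⁅_⁆; ⋃; ∣_∣; ⊤)
open import Data.List using (map; allFin)
open import Data.Product using (Σ; _×_; ∃)
open import Data.Sum using (_⊎_)
open import Relation.Binary.PropositionalEquality using (_≡_; _≢_)
open import Function.Definitions using (Injective)

-- A finite multigraph: vertex set Fin nV, edge instances Fin nE, each edge
-- instance joins two distinct vertices (an unordered pair from (V choose 2);
-- the orientation src/tgt carries no meaning).
record MGraph : Set where
  field
    nV     : ℕ
    nE     : ℕ
    src    : Fin nE → Fin nV
    tgt    : Fin nE → Fin nV
    noLoop : ∀ e → src e ≢ tgt e
open MGraph public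

-- A copy of F in G: a submultigraph of G isomorphic to F, written out as an
-- injective vertex map and an injective edge map respecting incidence
-- (endpoints as unordered pairs).
record Copy (F G : MGraph) : Set where
  field
    vmap   : Fin (nV F) → Fin (nV G)
    emap   : Fin (nE F) → Fin (nE G)
    vinj   : Injective _≡_ _≡_ vmap
    einj   : Injective _≡_ _≡_ emap
    incid  : ∀ e → (vmap (src F e) ≡ src G (emap e) × vmap (tgt F e) ≡ tgt G (emap e))
                 ⊎ (vmap (src F e) ≡ tgt G (emap e) × vmap (tgt F e) ≡ src G (emap e))
open Copy public

edges : {F G : MGraph} → Copy F G → Subset (nE G)
edges c = ⋃ (map (λ j → ⁅ emap c j ⁆) (allFin _))

data WSatFrom (G : MGraph) {I : Set} (𝓕 : I → MGraph) : Subset (nE G) → Set where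
  done : ∀ {S} → S ≡ ⊤ → WSatFrom G 𝓕 S
  step : ∀ {S} (e : Fin (nE G)) → e ∉ S →
         (i : I) (c : Copy (𝓕 i) G) → e ∈ edges c → edges c ⊆ (⁅ e ⁆ ∪ S) →
         WSatFrom G 𝓕 (⁅ e ⁆ ∪ S) → WSatFrom G 𝓕 S

WeaklySat : (G : MGraph) {I : Set} (𝓕 : I → MGraph) → Subset (nE G) → Set
WeaklySat G 𝓕 H = WSatFrom G 𝓕 H

record Matroid (m : ℕ) : Set where
  field
    rk        : Subset m → ℕ
    rk-bound  : ∀ X → rk X ≤ ∣ X ∣
    rk-mono   : ∀ X Y → X ⊆ Y → rk X ≤ rk Y
    rk-submod : ∀ X Y → rk (X ∪ Y) + rk (X ∩ Y) ≤ rk X + rk Y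
open Matroid public

-- M is weakly 𝓕-saturated: every copy of every member of 𝓕 is a cycle of M.
MatroidWSat : (G : MGraph) {I : Set} (𝓕 : I → MGraph) → Matroid (nE G) → Set
MatroidWSat G {I} 𝓕 M = ∀ (i : I) (c : Copy (𝓕 i) G) (e : Fin (nE G)) → e ∈ edges c →
                    rk M (edges c - e) ≡ rk M (edges c)

IsWsat : (G : MGraph) {I : Set} (𝓕 : I → MGraph) → ℕ → Set
IsWsat G 𝓕 k = (Σ (Subset (nE G)) λ H → WeaklySat G 𝓕 H × ∣ H ∣ ≡ k)
             × (∀ H → WeaklySat G 𝓕 H → k ≤ ∣ H ∣)

IsRkSat : (G : MGraph) {I : Set} (𝓕 : I → MGraph) → ℕ → Set
IsRkSat G 𝓕 r = (Σ (Matroid (nE G)) λ M → MatroidWSat G 𝓕 M × rk M ⊤ ≡ r)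
              × (∀ M → MatroidWSat G 𝓕 M → rk M ⊤ ≤ r)

{-# OPTIONS --safe #-}
module Submission where

-- Let M be a weakly 𝓕-saturated matroid and H a weakly 𝓕-saturated
-- submultigraph. Each edge e added in the saturation process lies in a copy C of
-- some F ∈ 𝓕 with C - e inside the current edge set S; since C is a cycle of M,
-- submodularity gives rk (S ∪ {e}) = rk S. Hence rk E(G) = rk H ≤ |H|.

open import Defs
open import Data.Nat using (ℕ; _≤_; _+_)
open import Data.Nat.Properties using (≤-refl; ≤-trans; +-monoʳ-≤; +-cancelʳ-≤; module ≤-Reasoning)
open import Data.Fin using (Fin)
open import Data.Vec using (_∷_; here; there)
open import Data.Fin.Subset using (Subset; _∈_; _∉_; _⊆_; _∪_; _∩_; _─_; _-_; ⁅_⁆; ⊤; inside)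
open import Data.Fin.Subset.Properties
  using (x∈⁅y⁆⇒x≡y; x∈p∪q⁺; x∈p∪q⁻; x∈p∩q⁺; p─q⊆p)
open import Data.Product using (_,_)
open import Data.Sum using (inj₁; inj₂)
open import Relation.Nullary using (contradiction)
open import Relation.Binary.PropositionalEquality using (_≡_; refl; subst)

x∈p─q⇒x∉q : ∀ {n} {x : Fin n} (p q : Subset n) → x ∈ p ─ q → x ∉ q
x∈p─q⇒x∉q (_ ∷ p) (_      ∷ q) (there x∈p─q) (there x∈q) = x∈p─q⇒x∉q p q x∈p─q x∈q
x∈p─q⇒x∉q (_ ∷ p) (inside ∷ q) ()            here

p⊆⁅x⁆∪q⇒p-x⊆q : ∀ {n} {x : Fin n} {p q : Subset n} → p ⊆ ⁅ x ⁆ ∪ q → p - x ⊆ q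
p⊆⁅x⁆∪q⇒p-x⊆q {x = x} {p} {q} p⊆⁅x⁆∪q y∈p-x
  with x∈p∪q⁻ ⁅ x ⁆ q (p⊆⁅x⁆∪q (p─q⊆p p ⁅ x ⁆ y∈p-x))
... | inj₁ y∈⁅x⁆ = contradiction y∈⁅x⁆ (x∈p─q⇒x∉q p ⁅ x ⁆ y∈p-x)
... | inj₂ y∈q   = y∈q

x∈q⇒⁅x⁆∪p⊆p∪q : ∀ {n} {x : Fin n} {p q : Subset n} → x ∈ q → ⁅ x ⁆ ∪ p ⊆ p ∪ q
x∈q⇒⁅x⁆∪p⊆p∪q {x = x} {p} x∈q y∈⁅x⁆∪p with x∈p∪q⁻ ⁅ x ⁆ p y∈⁅x⁆∪p
... | inj₁ y∈⁅x⁆ rewrite x∈⁅y⁆⇒x≡y x y∈⁅x⁆ = x∈p∪q⁺ (inj₂ x∈q)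
... | inj₂ y∈p   = x∈p∪q⁺ (inj₁ y∈p)

module _ {m : ℕ} (M : Matroid m) where

  rk-∪-≤ : ∀ S C → rk M C ≤ rk M (S ∩ C) → rk M (S ∪ C) ≤ rk M S
  rk-∪-≤ S C rkC≤rkS∩C = +-cancelʳ-≤ (rk M C) (rk M (S ∪ C)) (rk M S) (begin
    rk M (S ∪ C) + rk M C        ≤⟨ +-monoʳ-≤ (rk M (S ∪ C)) rkC≤rkS∩C ⟩
    rk M (S ∪ C) + rk M (S ∩ C)  ≤⟨ rk-submod M S C ⟩
    rk M S + rk M C              ∎)
    where open ≤-Reasoning

  rk-⁅e⁆∪S≤rk-S : ∀ {S C e} → e ∈ C → rk M (C - e) ≡ rk M C → C - e ⊆ S →
                  rk M (⁅ e ⁆ ∪ S) ≤ rk M S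
  rk-⁅e⁆∪S≤rk-S {S} {C} {e} e∈C C-cycle C-e⊆S = begin
    rk M (⁅ e ⁆ ∪ S)  ≤⟨ rk-mono M _ _ (x∈q⇒⁅x⁆∪p⊆p∪q e∈C) ⟩
    rk M (S ∪ C)      ≤⟨ rk-∪-≤ S C rkC≤rkS∩C ⟩
    rk M S            ∎
    where
    open ≤-Reasoning
    C-e⊆S∩C : C - e ⊆ S ∩ C
    C-e⊆S∩C x∈C-e = x∈p∩q⁺ (C-e⊆S x∈C-e , p─q⊆p C ⁅ e ⁆ x∈C-e)
    rkC≤rkS∩C : rk M C ≤ rk M (S ∩ C)
    rkC≤rkS∩C = subst (_≤ rk M (S ∩ C)) C-cycle (rk-mono M _ _ C-e⊆S∩C)

WSatFrom⇒rk⊤≤rk : ∀ {G I} {𝓕 : I → MGraph} (M : Matroid (nE G)) → MatroidWSat G 𝓕 M →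
                  ∀ {S} → WSatFrom G 𝓕 S → rk M ⊤ ≤ rk M S
WSatFrom⇒rk⊤≤rk M M-sat (done refl) = ≤-refl
WSatFrom⇒rk⊤≤rk M M-sat (step e _ i c e∈c c⊆⁅e⁆∪S rest) =
  ≤-trans (WSatFrom⇒rk⊤≤rk M M-sat rest)
          (rk-⁅e⁆∪S≤rk-S M e∈c (M-sat i c e e∈c) (p⊆⁅x⁆∪q⇒p-x⊆q c⊆⁅e⁆∪S))

lemma2 : (G : MGraph) (I : Set) (𝓕 : I → MGraph) (w r : ℕ) →
         IsWsat G 𝓕 w → IsRkSat G 𝓕 r → r ≤ w
lemma2 G I 𝓕 w r ((H , H-sat , refl) , _) ((M , M-sat , refl) , _) =
  ≤-trans (WSatFrom⇒rk⊤≤rk M M-sat H-sat) (rk-bound M H)
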